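{- Let $G=(V,E)$ be the graph with vertex set $V=\{a,b,c,d,e\}$ and edge set $E=\{\{a,b\},\{b,c\},\{c,d\},\{d,e\},\{e,a\},\{b,d\}\}$. Then every minimum planar arrangement $\pi$ of $G$ has cost $\sum_{\{u,v\}\in E}|\pi(u)-\pi(v)|$ strictly larger than $9$.
   Context: For a graph $G=(V,E)$ with $n=|V|$ vertices, a linear arrangement of $G$ is a bijection $\pi: V\to\{1,\dots,n\}$, and its cost is $\sum_{\{u,v\}\in E}|\pi(u)-\pi(v)|$. Two distinct edges $\{u,v\},\{x,y\}\in E$ cross in $\pi$ if, for some labeling of their endpoints, $\pi(u)<\pi(x)<\pi(v)<\pi(y)$. Following the paper's terminology, a "minimum planar arrangement" of $G$ is any linear arrangement $\pi$ of $G$ in which no two edges of $G$ cross (no minimality of cost is part of this definition). -}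

module Defs where

open import Data.Nat using (ℕ; _<_; _+_; ∣_-_∣)
open import Data.Fin using (Fin; toℕ; zero; suc)
open import Data.Product using (_×_; _,_; ∃-syntax; proj₁; proj₂)
open import Data.Sum using (_⊎_)
open import Data.List using (List; []; _∷_; map)
open import Data.Nat.ListAction using (sum)
open import Relation.Nullary using (¬_)
open import Relation.Binary.PropositionalEquality using (_≡_; _≢_)
open import Function.Bundles using (_⤖_; Bijection)

-- A general simple graph on n vertices given by an enumerated list of m edges
-- (each edge an unordered pair, represented by an ordered pair of endpoints).

-- Linear arrangement: bijection V → positions. Positions are Fin n = {0,…,n-1}
-- instead of {1,…,n}; this shift changes neither costs nor crossings.
Arrangement : ℕ → Set
Arrangement n = Fin n ⤖ Fin n

pos : {n : ℕ} → Arrangement n → Fin n → ℕ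
pos π v = toℕ (Bijection.to π v)

Edge : ℕ → Set
Edge n = Fin n × Fin n

flipE : {n : ℕ} → Edge n → Edge n
flipE (u , v) = (v , u)

Interleave : {n : ℕ} → Arrangement n → Edge n → Edge n → Set
Interleave π (u , v) (x , y) =
  (pos π u < pos π x) × (pos π x < pos π v) × (pos π v < pos π y)

Crosses : {n : ℕ} → Arrangement n → Edge n → Edge n → Set
Crosses π e f =
  ∃[ e' ] ∃[ f' ] ((e' ≡ e ⊎ e' ≡ flipE e) × (f' ≡ f ⊎ f' ≡ flipE f)
                   × (Interleave π e' f' ⊎ Interleave π f' e'))

cost : {n : ℕ} → Arrangement n → List (Edge n) → ℕ
cost π es = sum (map (λ e → ∣ pos π (proj₁ e) - pos π (proj₂ e) ∣) es)

-- "minimum planar arrangement" in the paper's sense: no two distinct edges cross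
Planar : {n m : ℕ} → Arrangement n → (Fin m → Edge n) → Set
Planar {m = m} π E = (i j : Fin m) → i ≢ j → ¬ Crosses π (E i) (E j)

a b c d e : Fin 5
a = zero
b = suc zero
c = suc (suc zero)
d = suc (suc (suc zero))
e = suc (suc (suc (suc zero)))

G-edges : Fin 6 → Edge 5
G-edges zero = (a , b)
G-edges (suc zero) = (b , c)
G-edges (suc (suc zero)) = (c , d)
G-edges (suc (suc (suc zero))) = (d , e)
G-edges (suc (suc (suc (suc zero)))) = (e , a)
G-edges (suc (suc (suc (suc (suc zero))))) = (b , d)

G-edgeList : List (Edge 5)
G-edgeList = G-edges 0F' ∷ G-edges 1F' ∷ G-edges 2F' ∷ G-edges 3F' ∷ G-edges 4F' ∷ G-edges 5F' ∷ []
  where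
  0F' 1F' 2F' 3F' 4F' 5F' : Fin 6
  0F' = zero
  1F' = suc zero
  2F' = suc (suc zero)
  3F' = suc (suc (suc zero))
  4F' = suc (suc (suc (suc zero)))
  5F' = suc (suc (suc (suc (suc zero))))

-- The theorem is a finite check: an arrangement is determined by the map
-- sending each of the five vertices to its position, and every map
-- Fin 5 → Fin 5 is either non-injective, makes two distinct edges cross, or
-- has cost at least 10.  (Cost 9 would force the 5-cycle abcde to be laid out
-- at its minimum cost 8 and the chord bd to join adjacent positions; all such
-- layouts have a crossing.)  A boolean verdict is evaluated on all 5^5 maps and
-- reflected back to the propositions of the statement.
module Submission where

open import Defs
open import Data.Bool using (Bool; T; not; _∧_; _∨_)
open import Data.Bool.Properties using (T-∧; T-∨)
open import Data.Empty using (⊥-elim)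
open import Data.Fin using (Fin; toℕ; _≟_)
open import Data.Fin.Properties using (all?)
open import Data.List using (List; []; _∷_; map; allFin; cartesianProduct)
open import Data.Bool.ListAction using (any)
open import Data.List.Relation.Unary.Any using (Any; here; there; satisfied)
open import Data.List.Relation.Unary.Any.Properties using (any⁻)
open import Data.Nat using (ℕ; _<_; _<ᵇ_; ∣_-_∣)
open import Data.Nat.ListAction using (sum)
open import Data.Nat.Properties using (<ᵇ⇒<)
open import Data.Product using (_×_; _,_; ∃-syntax; proj₁; proj₂)
open import Data.Sum using (_⊎_; inj₁; inj₂)
open import Data.Vec using (_∷_; []; lookup)
open import Function.Bundles using (Bijection; Equivalence)
open import Relation.Binary.PropositionalEquality using (_≡_; _≢_; refl)
open import Relation.Nullary using (¬_)
open import Relation.Nullary.Decidable using (⌊_⌋; T?; from-yes; toWitness; toWitnessFalse)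

allPairs : (n : ℕ) → List (Fin n × Fin n)
allPairs n = cartesianProduct (allFin n) (allFin n)

labellings : {n : ℕ} → Edge n → List (Edge n)
labellings e = e ∷ flipE e ∷ []

labellings-satisfied : {n : ℕ} {Q : Edge n → Set} (e : Edge n) →
               Any Q (labellings e) → ∃[ e' ] (e' ≡ e ⊎ e' ≡ flipE e) × Q e'
labellings-satisfied e (here q)         = e , inj₁ refl , q
labellings-satisfied e (there (here q)) = flipE e , inj₂ refl , q

module Verdict {n m : ℕ} (place : Fin n → Fin n) (E : Fin m → Edge n) (es : List (Edge n)) where

  precedes : Fin n → Fin n → Bool
  precedes u v = toℕ (place u) <ᵇ toℕ (place v)

  interleaves : Edge n → Edge n → Bool
  interleaves (u , v) (x , y) = precedes u x ∧ (precedes x v ∧ precedes v y)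

  interleave-either : Edge n → Edge n → Bool
  interleave-either e f = interleaves e f ∨ interleaves f e

  crosses : Edge n → Edge n → Bool
  crosses e f = any (λ e' → any (interleave-either e') (labellings f)) (labellings e)

  distinct-and : {k : ℕ} → (Fin k → Fin k → Bool) → Fin k × Fin k → Bool
  distinct-and test (i , j) = not ⌊ i ≟ j ⌋ ∧ test i j

  collision : Bool
  collision = any (distinct-and (λ u v → ⌊ place u ≟ place v ⌋)) (allPairs n)

  tangle : Bool
  tangle = any (distinct-and (λ i j → crosses (E i) (E j))) (allPairs m)

  costOf : ℕ
  costOf = sum (map (λ e → ∣ toℕ (place (proj₁ e)) - toℕ (place (proj₂ e)) ∣) es)

  verdict : ℕ → Bool
  verdict bound = collision ∨ (tangle ∨ (bound <ᵇ costOf))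

module Soundness {n m : ℕ} (π : Arrangement n) (E : Fin m → Edge n) (es : List (Edge n)) where
  place : Fin n → Fin n
  place = Bijection.to π

  open Verdict place E es

  distinct-and-sound : {k : ℕ} (test : Fin k → Fin k → Bool) {P : Fin k → Fin k → Set} →
                       (∀ i j → T (test i j) → P i j) →
                       T (any (distinct-and test) (allPairs k)) → ∃[ i ] ∃[ j ] i ≢ j × P i j
  distinct-and-sound {k} test sound t =
    let (i , j) , t′ = satisfied (any⁻ (distinct-and test) (allPairs k) t)
        i≢j , tij = Equivalence.to T-∧ t′
    in i , j , toWitnessFalse i≢j , sound i j tij

  interleaves-sound : (e f : Edge n) → T (interleaves e f) → Interleave π e f
  interleaves-sound (u , v) (x , y) t =
    let ux , t′ = Equivalence.to T-∧ t
        xv , vy = Equivalence.to T-∧ t′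
    in <ᵇ⇒< _ _ ux , <ᵇ⇒< _ _ xv , <ᵇ⇒< _ _ vy

  crosses-sound : (e f : Edge n) → T (crosses e f) → Crosses π e f
  crosses-sound e f t =
    let e' , e'-labels-e , t′ = labellings-satisfied e (any⁻ (λ e' → any (interleave-either e') (labellings f))
                                                     (labellings e) t)
        f' , f'-labels-f , t″ = labellings-satisfied f (any⁻ (interleave-either e') (labellings f) t′)
    in e' , f' , e'-labels-e , f'-labels-f , orientation e' f' (Equivalence.to T-∨ t″)
    where
    orientation : (e' f' : Edge n) → T (interleaves e' f') ⊎ T (interleaves f' e') →
                  Interleave π e' f' ⊎ Interleave π f' e'
    orientation e' f' (inj₁ i) = inj₁ (interleaves-sound e' f' i)
    orientation e' f' (inj₂ i) = inj₂ (interleaves-sound f' e' i)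

  no-collision : ¬ T collision
  no-collision t =
    let u , v , u≢v , same = distinct-and-sound (λ u v → ⌊ place u ≟ place v ⌋) (λ _ _ → toWitness) t
    in u≢v (Bijection.injective π same)

  planar⇒no-tangle : Planar π E → ¬ T tangle
  planar⇒no-tangle planar t =
    let i , j , i≢j , cross = distinct-and-sound (λ i j → crosses (E i) (E j))
                                                 (λ i j → crosses-sound (E i) (E j)) t
    in planar i j i≢j cross

  verdict-sound : (bound : ℕ) → Planar π E → T (verdict bound) → bound < cost π es
  verdict-sound bound planar t with Equivalence.to T-∨ t
  ... | inj₁ c = ⊥-elim (no-collision c)
  ... | inj₂ t′ with Equivalence.to T-∨ t′
  ... | inj₁ c = ⊥-elim (planar⇒no-tangle planar c)
  ... | inj₂ b = <ᵇ⇒< bound _ b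

G-verdict : (Fin 5 → Fin 5) → Bool
G-verdict place = Verdict.verdict place G-edges G-edgeList 9

G-verdict-exhaustive : ∀ x₀ x₁ x₂ x₃ x₄ → T (G-verdict (lookup (x₀ ∷ x₁ ∷ x₂ ∷ x₃ ∷ x₄ ∷ [])))
G-verdict-exhaustive =
  from-yes (all? λ x₀ → all? λ x₁ → all? λ x₂ → all? λ x₃ → all? λ x₄ →
            T? (G-verdict (lookup (x₀ ∷ x₁ ∷ x₂ ∷ x₃ ∷ x₄ ∷ []))))

-- G-verdict inspects its argument only at the five closed vertices, where
-- lookup of the tabulated values computes, so both sides have the same normal form.
G-verdict-holds : (place : Fin 5 → Fin 5) → T (G-verdict place)
G-verdict-holds place = G-verdict-exhaustive (place a) (place b) (place c) (place d) (place e)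

theorem1 : (π : Arrangement 5) → Planar π G-edges → 9 < cost π G-edgeList
theorem1 π planar =
  Soundness.verdict-sound π G-edges G-edgeList 9 planar (G-verdict-holds (Bijection.to π))
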